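{- Let $q=p^{\alpha}$, where $p$ is a prime and $\alpha$ a positive integer, and list the elements of $GF(q)$ as $a_0=0,a_1,\dots,a_{q-1}$. Let $t,s$ be integers with $1\leq t,s<\frac{q-1}{2}$, and let $A=[a_{ij}]$ and $B=[b_{ij}]$ be the $q\times q$ matrices over $GF(q)$ with entries $a_{ij}=a_j^{t}-a_i^{t}$ and $b_{ij}=a_j^{s}-a_i^{s}$ for $0\le i,j\le q-1$. Then $AB=\mathbf{0}$ over $GF(q)$. -}

module Defs where

open import Level using (Level; _⊔_; suc)
open import Data.Nat using (ℕ)
open import Data.Fin using (Fin)
open import Data.Product using (∃)
open import Relation.Nullary using (¬_)
open import Relation.Binary.PropositionalEquality using (_≡_)
open import Algebra.Bundles using (CommutativeRing; Semiring)
import Algebra.Definitions.RawSemiring as RS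

record Field (c ℓ : Level) : Set (suc (c ⊔ ℓ)) where
  field
    commutativeRing : CommutativeRing c ℓ
  open CommutativeRing commutativeRing public
  field
    0≉1     : ¬ (0# ≈ 1#)
    inverse : ∀ x → ¬ (x ≈ 0#) → ∃ λ y → (x * y) ≈ 1#
  open RS (Semiring.rawSemiring semiring) public using (_^_; sum)

module _ {c ℓ} (F : Field c ℓ) where
  open Field F

  -- A listing a₀, …, a_{q-1} of all elements of F without repetition:
  -- a function Fin q → F, injective and surjective up to ≈.
  -- Its existence means F has exactly q elements, i.e. F is GF(q).
  record Listing (q : ℕ) : Set (c ⊔ ℓ) where
    field
      elt        : Fin q → Carrier
      injective  : ∀ i j → elt i ≈ elt j → i ≡ j
      surjective : ∀ x → ∃ λ i → elt i ≈ x

  Matrix : ℕ → Set c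
  Matrix q = Fin q → Fin q → Carrier

  _⊗_ : ∀ {q} → Matrix q → Matrix q → Matrix q
  (A ⊗ B) i k = sum (λ j → A i j * B j k)

  IsZeroMatrix : ∀ {q} → Matrix q → Set ℓ
  IsZeroMatrix M = ∀ i k → M i k ≈ 0#

module Submission where

open import Defs
open import Data.Nat using (ℕ; _*_; _^_; _≤_; _<_; _∸_)
open import Data.Nat.Primality using (Prime)
open import Data.Fin using (Fin; toℕ)
open import Relation.Binary.PropositionalEquality using (_≡_)

-- Write ∑ₓ for the sum over all q elements x of the
-- field.  The (i,k) entry of AB is
--   ∑ⱼ (aⱼᵗ − aᵢᵗ)(aₖˢ − aⱼˢ) = aₖˢ·∑ⱼaⱼᵗ − q·aᵢᵗaₖˢ + aᵢᵗ·∑ⱼaⱼˢ − ∑ⱼaⱼᵗ⁺ˢ,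
-- so it suffices that ∑ₓ 1 = 0 and that the power sums ∑ₓ xᵐ vanish for
-- 0 < m < q − 1 (the hypotheses give t + s < q − 1).
--   * ∑ₓ 1 = 0: translation x ↦ x + 1 permutes the field, so
--     ∑ₓ x = ∑ₓ (x + 1) = ∑ₓ x + ∑ₓ 1.
--   * ∑ₓ xᵐ = 0: if some c ≠ 0 has cᵐ ≠ 1, the permutation x ↦ cx gives
--     ∑ₓ xᵐ = cᵐ ∑ₓ xᵐ, forcing the sum to vanish.  Otherwise every element
--     is a root of Xᵐ⁺¹ − X, a nonzero polynomial of degree m + 1 < q,
--     which has at most m + 1 roots in a field.

open import Data.Nat.Properties using (≤-trans; ≤-<-trans; m≤m+n; m≤n+m; ≤-total; +-monoˡ-≤; +-monoʳ-≤)
import Data.Nat as ℕ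
open import Data.Fin.Properties using (suc-injective; inject≤-injective; any?)
open import Data.Fin.Permutation using (permutation)
open import Data.Vec using (Vec; []; _∷_; last)
open import Function using (_∘′_)
import Data.Fin as Fin
open import Data.Product using (_,_; proj₁; proj₂)
open import Data.Sum using (inj₁; inj₂)
open import Data.Empty using (⊥-elim)
open import Relation.Nullary using (¬_; Dec; yes; no)
open import Relation.Nullary.Decidable using (_×-dec_; ¬?; decidable-stable)
import Relation.Binary.PropositionalEquality as ≡
open import Algebra.Bundles using (CommutativeRing; Semiring)

module CommutativeRingFacts {c ℓ} (R : CommutativeRing c ℓ) where
  open CommutativeRing R renaming (_*_ to _·_; Carrier to C)
  open import Algebra.Definitions.RawSemiring (Semiring.rawSemiring semiring) using (sum) renaming (_^_ to _^ᶠ_)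
  open import Algebra.Properties.Semiring.Sum semiring using (sum-cong-≋; ∑-distrib-+; *-distribˡ-sum)
  open import Algebra.Properties.Ring ring using (x[y-z]≈xy-xz; [y-z]x≈yx-zx; -1*x≈-x; //-rightDividesˡ)
  open import Algebra.Properties.CommutativeSemigroup *-commutativeSemigroup using (x∙yz≈y∙xz)
  open import Relation.Binary.Reasoning.Setoid setoid

  -- A family whose sum is zero.  Such families are closed under sums,
  -- differences and scaling; the record keeps the family inferable.
  record SumsToZero {n} (f : Fin n → C) : Set ℓ where
    constructor sums-to-zero
    field sum≈0 : sum f ≈ 0#
  open SumsToZero public

  sumsToZero-cong : ∀ {n} {f g : Fin n → C} → (∀ i → f i ≈ g i) → SumsToZero f → SumsToZero g
  sumsToZero-cong f≈g (sums-to-zero Σf≈0) = sums-to-zero (trans (sym (sum-cong-≋ f≈g)) Σf≈0)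

  sumsToZero-+ : ∀ {n} {f g : Fin n → C} → SumsToZero f → SumsToZero g → SumsToZero (λ i → f i + g i)
  sumsToZero-+ {f = f} {g} (sums-to-zero Σf≈0) (sums-to-zero Σg≈0) =
    sums-to-zero (trans (∑-distrib-+ f g) (trans (+-cong Σf≈0 Σg≈0) (+-identityˡ 0#)))

  sumsToZero-scaleˡ : ∀ {n} k {f : Fin n → C} → SumsToZero f → SumsToZero (λ i → k · f i)
  sumsToZero-scaleˡ k {f} (sums-to-zero Σf≈0) =
    sums-to-zero (trans (sym (*-distribˡ-sum k f)) (trans (*-congˡ Σf≈0) (zeroʳ k)))

  sumsToZero-scaleʳ : ∀ {n} k {f : Fin n → C} → SumsToZero f → SumsToZero (λ i → f i · k)
  sumsToZero-scaleʳ k Σf≈0 = sumsToZero-cong (λ i → *-comm k _) (sumsToZero-scaleˡ k Σf≈0)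

  sumsToZero-- : ∀ {n} {f g : Fin n → C} → SumsToZero f → SumsToZero g → SumsToZero (λ i → f i - g i)
  sumsToZero-- Σf≈0 Σg≈0 =
    sumsToZero-+ Σf≈0 (sumsToZero-cong (λ i → -1*x≈-x _) (sumsToZero-scaleˡ (- 1#) Σg≈0))

  product-of-differences : ∀ {n} (X Y : Fin n → C) u v →
    SumsToZero (λ (_ : Fin n) → 1#) → SumsToZero X → SumsToZero Y →
    SumsToZero (λ j → X j · Y j) → SumsToZero (λ j → (X j - u) · (v - Y j))
  product-of-differences X Y u v Σ1≈0 ΣX≈0 ΣY≈0 ΣXY≈0 = sumsToZero-cong expand
    (sumsToZero-- (sumsToZero-- (sumsToZero-scaleʳ v ΣX≈0) constant)
                  (sumsToZero-- ΣXY≈0 (sumsToZero-scaleˡ u ΣY≈0)))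
    where
    constant : SumsToZero (λ _ → u · v)
    constant = sumsToZero-cong (λ _ → *-identityʳ (u · v)) (sumsToZero-scaleˡ (u · v) Σ1≈0)
    expand : ∀ j → (X j · v - u · v) - (X j · Y j - u · Y j) ≈ (X j - u) · (v - Y j)
    expand j = sym (trans (x[y-z]≈xy-xz (X j - u) v (Y j))
                          (+-cong ([y-z]x≈yx-zx v (X j) u) (-‿cong ([y-z]x≈yx-zx (Y j) (X j) u))))

  -- Polynomials as coefficient vectors a₀ ∷ a₁ ∷ … ∷ aₙ, constant term
  -- first; `last` is the leading coefficient.  Evaluation by Horner's rule.
  eval : ∀ {n} → Vec C n → C → C
  eval []       x = 0#
  eval (a ∷ as) x = a + x · eval as x

  eval-constant : ∀ a x → eval (a ∷ []) x ≈ a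
  eval-constant a x = trans (+-congˡ (zeroʳ x)) (+-identityʳ a)

  -- Synthetic division by X − r: the quotient of a + X·p is p(r) + X·(p div (X − r)).
  divide : ∀ {n} → C → Vec C (ℕ.suc n) → Vec C n
  divide r (a ∷ [])         = []
  divide r (a ∷ as@(_ ∷ _)) = eval as r ∷ divide r as

  factor-theorem : ∀ {n} r (p : Vec C (ℕ.suc n)) x →
                   eval p x ≈ eval p r + (x - r) · eval (divide r p) x
  factor-theorem r (a ∷ []) x = trans (eval-constant a x)
    (sym (trans (+-cong (eval-constant a r) (zeroʳ (x - r))) (+-identityʳ a)))
  factor-theorem r (a ∷ as@(_ ∷ _)) x = begin
      a + x · eval as x                         ≈⟨ +-congˡ (*-congˡ (factor-theorem r as x)) ⟩
      a + x · (b + (x - r) · d)                 ≈⟨ +-congˡ (distribˡ x b ((x - r) · d)) ⟩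
      a + (x · b + x · ((x - r) · d))           ≈⟨ +-congˡ (+-cong split (x∙yz≈y∙xz x (x - r) d)) ⟩
      a + ((r · b + (x - r) · b) + (x - r) · (x · d)) ≈⟨ +-congˡ (+-assoc _ _ _) ⟩
      a + (r · b + ((x - r) · b + (x - r) · (x · d))) ≈⟨ sym (+-assoc _ _ _) ⟩
      (a + r · b) + ((x - r) · b + (x - r) · (x · d)) ≈⟨ +-congˡ (sym (distribˡ (x - r) b (x · d))) ⟩
      (a + r · b) + (x - r) · (b + x · d)       ∎
    where
    b d : C
    b = eval as r
    d = eval (divide r as) x
    split : x · b ≈ r · b + (x - r) · b
    split = sym (trans (+-congˡ ([y-z]x≈yx-zx b x r)) (trans (+-comm _ _) (//-rightDividesˡ (r · b) (x · b))))

  last-divide : ∀ {n} r (p : Vec C (ℕ.suc (ℕ.suc n))) → last (divide r p) ≈ last p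
  last-divide r (a ∷ b ∷ [])         = eval-constant b r
  last-divide r (a ∷ as@(_ ∷ _ ∷ _)) = last-divide r as

  monomial : ∀ n → Vec C (ℕ.suc n)
  monomial ℕ.zero    = 1# ∷ []
  monomial (ℕ.suc n) = 0# ∷ monomial n

  eval-monomial : ∀ n x → eval (monomial n) x ≈ x ^ᶠ n
  eval-monomial ℕ.zero    x = eval-constant 1# x
  eval-monomial (ℕ.suc n) x = trans (+-identityˡ _) (*-congˡ (eval-monomial n x))

  last-monomial : ∀ n → last (monomial n) ≡ 1#
  last-monomial ℕ.zero    = ≡.refl
  last-monomial (ℕ.suc n) = last-monomial n

module FieldFacts {c ℓ} (F : Field c ℓ) where
  open Field F renaming (_*_ to _·_; _^_ to _^ᶠ_; Carrier to C)
  open CommutativeRingFacts commutativeRing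
  open import Algebra.Properties.Ring ring using (x∙y⁻¹≈ε⇒x≈y; [y-z]x≈yx-zx)
  open import Relation.Binary.Reasoning.Setoid setoid

  cancel-nonzero : ∀ {a b} → ¬ a ≈ 0# → a · b ≈ 0# → b ≈ 0#
  cancel-nonzero {a} {b} a≉0 ab≈0 with inverse a a≉0
  ... | a⁻¹ , aa⁻¹≈1 = begin
    b              ≈⟨ sym (*-identityˡ b) ⟩
    1# · b         ≈⟨ *-congʳ (sym (trans (*-comm a⁻¹ a) aa⁻¹≈1)) ⟩
    (a⁻¹ · a) · b  ≈⟨ *-assoc a⁻¹ a b ⟩
    a⁻¹ · (a · b)  ≈⟨ *-congˡ ab≈0 ⟩
    a⁻¹ · 0#       ≈⟨ zeroʳ a⁻¹ ⟩
    0#             ∎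

  -- If multiplication by some k ≠ 1 fixes a, then a = 0: (k − 1)·a = 0.
  fixed-by-non-one : ∀ {a k} → a ≈ k · a → ¬ k ≈ 1# → a ≈ 0#
  fixed-by-non-one {a} {k} a≈ka k≉1 = cancel-nonzero (k≉1 ∘′ x∙y⁻¹≈ε⇒x≈y k 1#) (begin
    (k - 1#) · a    ≈⟨ [y-z]x≈yx-zx a k 1# ⟩
    k · a - 1# · a  ≈⟨ +-cong (sym a≈ka) (-‿cong (*-identityˡ a)) ⟩
    a - a           ≈⟨ -‿inverseʳ a ⟩
    0#              ∎)

  -- A polynomial of degree n with nonzero leading coefficient has no n + 1
  -- distinct roots: divide by X − r₀ and recurse on the remaining roots.
  root-bound : ∀ n (p : Vec C (ℕ.suc n)) → ¬ last p ≈ 0# →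
               (r : Fin (ℕ.suc n) → C) → (∀ i j → r i ≈ r j → i ≡ j) →
               ¬ (∀ i → eval p (r i) ≈ 0#)
  root-bound ℕ.zero (a ∷ []) a≉0 r _ roots = a≉0 (trans (sym (eval-constant a (r Fin.zero))) (roots Fin.zero))
  root-bound (ℕ.suc n) p lead≉0 r distinct roots =
    root-bound n (divide r₀ p) (lead≉0 ∘′ trans (sym (last-divide r₀ p)))
      (λ i → r (Fin.suc i)) (λ i j eq → suc-injective (distinct _ _ eq)) quotient-roots
    where
    r₀ : C
    r₀ = r Fin.zero
    quotient-roots : ∀ i → eval (divide r₀ p) (r (Fin.suc i)) ≈ 0#
    quotient-roots i = cancel-nonzero distinct-from-r₀ (begin
        (x - r₀) · eval (divide r₀ p) x           ≈⟨ sym (+-identityˡ _) ⟩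
        0# + (x - r₀) · eval (divide r₀ p) x      ≈⟨ +-congʳ (sym (roots Fin.zero)) ⟩
        eval p r₀ + (x - r₀) · eval (divide r₀ p) x ≈⟨ sym (factor-theorem r₀ p x) ⟩
        eval p x                                  ≈⟨ roots (Fin.suc i) ⟩
        0#                                        ∎)
      where
      x : C
      x = r (Fin.suc i)
      distinct-from-r₀ : ¬ x - r₀ ≈ 0#
      distinct-from-r₀ x-r₀≈0 with distinct _ _ (x∙y⁻¹≈ε⇒x≈y x r₀ x-r₀≈0)
      ... | ()

module FiniteField {c ℓ} (F : Field c ℓ) {q : ℕ} (L : Listing F q) where
  open Field F renaming (_*_ to _·_; _^_ to _^ᶠ_; Carrier to C)
  open Listing L
  open CommutativeRingFacts commutativeRing
  open FieldFacts F
  open import Algebra.Properties.Semiring.Sum semiring using (sum-cong-≋; sum-permute; ∑-distrib-+; *-distribˡ-sum)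
  open import Algebra.Properties.Ring ring using (+-identityʳ-unique; //-rightDividesˡ; //-rightDividesʳ)
  open import Algebra.Properties.CommutativeSemiring.Exp commutativeSemiring using (^-distrib-*)
  open import Algebra.Properties.Semiring.Exp semiring using (^-congˡ; ^-homo-*)
  open import Relation.Binary.Reasoning.Setoid setoid

  -- Equality in a finite field is decidable: compare positions in the listing.
  infix 4 _≟_
  _≟_ : ∀ x y → Dec (x ≈ y)
  x ≟ y with surjective x | surjective y
  ... | i , aᵢ≈x | j , aⱼ≈y with i Fin.≟ j
  ... | yes ≡.refl = yes (trans (sym aᵢ≈x) aⱼ≈y)
  ... | no i≢j     = no (λ x≈y → i≢j (injective i j (trans aᵢ≈x (trans x≈y (sym aⱼ≈y)))))

  -- Summing over all elements is invariant under any bijection g of the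
  -- field (with inverse h): g induces a permutation of the positions.
  sum-bijection : (g h : C → C) → (∀ {x y} → x ≈ y → g x ≈ g y) → (∀ {x y} → x ≈ y → h x ≈ h y) →
                  (∀ x → g (h x) ≈ x) → (∀ x → h (g x) ≈ x) →
                  (f : C → C) → (∀ {x y} → x ≈ y → f x ≈ f y) →
                  sum (λ i → f (elt i)) ≈ sum (λ i → f (g (elt i)))
  sum-bijection g h g-cong h-cong gh≈id hg≈id f f-cong =
    trans (sum-permute (λ i → f (elt i)) (permutation σ τ στ≡id τσ≡id))
          (sum-cong-≋ (λ i → f-cong (position-of (g (elt i)))))
    where
    position-of : ∀ x → elt (proj₁ (surjective x)) ≈ x
    position-of x = proj₂ (surjective x)
    σ τ : Fin q → Fin q
    σ i = proj₁ (surjective (g (elt i)))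
    τ i = proj₁ (surjective (h (elt i)))
    στ≡id : ∀ i → σ (τ i) ≡ i
    στ≡id i = injective _ _ (trans (position-of _) (trans (g-cong (position-of _)) (gh≈id (elt i))))
    τσ≡id : ∀ i → τ (σ i) ≡ i
    τσ≡id i = injective _ _ (trans (position-of _) (trans (h-cong (position-of _)) (hg≈id (elt i))))

  -- The characteristic divides q: ∑ₓ 1 = 0, by translating x ↦ x + 1.
  sum-of-ones : SumsToZero (λ (_ : Fin q) → 1#)
  sum-of-ones = sums-to-zero (+-identityʳ-unique (sum elt) (sum ones) (sym (begin
    sum elt                              ≈⟨ sum-bijection (_+ 1#) (_- 1#) +-congʳ +-congʳ
                                              (λ x → //-rightDividesˡ 1# x) (λ x → //-rightDividesʳ 1# x)
                                              (λ x → x) (λ x≈y → x≈y) ⟩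
    sum (λ i → elt i + 1#)               ≈⟨ ∑-distrib-+ elt ones ⟩
    sum elt + sum ones                   ∎)))
    where
    ones : Fin q → C
    ones _ = 1#

  -- Scaling by c ≠ 0 permutes the field, so ∑ₓ xᵐ = ∑ₓ (cx)ᵐ = cᵐ·∑ₓ xᵐ.
  power-sum-scaling : ∀ m {c} → ¬ c ≈ 0# → sum (λ i → elt i ^ᶠ m) ≈ c ^ᶠ m · sum (λ i → elt i ^ᶠ m)
  power-sum-scaling m {c} c≉0 with inverse c c≉0
  ... | c⁻¹ , cc⁻¹≈1 = begin
    sum (λ i → elt i ^ᶠ m)               ≈⟨ sum-bijection (c ·_) (c⁻¹ ·_) *-congˡ *-congˡ
                                              (cancel c c⁻¹ cc⁻¹≈1) (cancel c⁻¹ c (trans (*-comm c⁻¹ c) cc⁻¹≈1))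
                                              (_^ᶠ m) (^-congˡ m) ⟩
    sum (λ i → (c · elt i) ^ᶠ m)         ≈⟨ sum-cong-≋ (λ i → ^-distrib-* c (elt i) m) ⟩
    sum (λ i → c ^ᶠ m · elt i ^ᶠ m)      ≈⟨ sym (*-distribˡ-sum (c ^ᶠ m) (λ i → elt i ^ᶠ m)) ⟩
    c ^ᶠ m · sum (λ i → elt i ^ᶠ m)      ∎
    where
    cancel : ∀ a b → a · b ≈ 1# → ∀ x → a · (b · x) ≈ x
    cancel a b ab≈1 x = trans (sym (*-assoc a b x)) (trans (*-congʳ ab≈1) (*-identityˡ x))

  -- If m ≥ 1 and m + 2 ≤ q, not every nonzero element is an m-th root of
  -- unity: otherwise all q elements would be roots of Xᵐ⁺¹ − X.
  not-all-roots-of-unity : ∀ m → 1 ≤ m → ℕ.suc m < q → ¬ (∀ i → ¬ elt i ≈ 0# → elt i ^ᶠ m ≈ 1#)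
  not-all-roots-of-unity (ℕ.suc m′) _ m+2≤q all-roots =
    root-bound (ℕ.suc m) Xᵐ⁺¹-X leading≉0 root distinct (λ j → is-root (position j))
    where
    m : ℕ
    m = ℕ.suc m′
    Xᵐ⁺¹-X : Vec C (ℕ.suc (ℕ.suc m))
    Xᵐ⁺¹-X = 0# ∷ - 1# ∷ monomial m′
    leading≉0 : ¬ last Xᵐ⁺¹-X ≈ 0#
    leading≉0 = ≡.subst (λ a → ¬ a ≈ 0#) (≡.sym (last-monomial m′)) (λ 1≈0 → 0≉1 (sym 1≈0))
    position : Fin (ℕ.suc (ℕ.suc m)) → Fin q
    position j = Fin.inject≤ j m+2≤q
    root : Fin (ℕ.suc (ℕ.suc m)) → C
    root j = elt (position j)
    distinct : ∀ i j → root i ≈ root j → i ≡ j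
    distinct i j aᵢ≈aⱼ = inject≤-injective _ _ i j (injective _ _ aᵢ≈aⱼ)
    eval-Xᵐ⁺¹-X : ∀ x → eval Xᵐ⁺¹-X x ≈ x · (- 1# + x ^ᶠ m)
    eval-Xᵐ⁺¹-X x = trans (+-identityˡ _) (*-congˡ (+-congˡ (*-congˡ (eval-monomial m′ x))))
    is-root : ∀ i → eval Xᵐ⁺¹-X (elt i) ≈ 0#
    is-root i with elt i ≟ 0#
    ... | yes aᵢ≈0 = trans (eval-Xᵐ⁺¹-X (elt i)) (trans (*-congʳ aᵢ≈0) (zeroˡ _))
    ... | no aᵢ≉0  = trans (eval-Xᵐ⁺¹-X (elt i))
                      (trans (*-congˡ (trans (+-congˡ (all-roots i aᵢ≉0)) (-‿inverseˡ 1#))) (zeroʳ (elt i)))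

  -- Power sums vanish: ∑ₓ xᵐ = 0 for 0 < m < q − 1.  Either some c ≠ 0 has
  -- cᵐ ≠ 1 and the scaling identity forces the sum to be 0, or every
  -- nonzero element is an m-th root of unity, which is impossible.
  power-sum-vanishes : ∀ m → 1 ≤ m → ℕ.suc m < q → SumsToZero (λ i → elt i ^ᶠ m)
  power-sum-vanishes m 1≤m m+2≤q with any? (λ i → ¬? (elt i ≟ 0#) ×-dec ¬? (elt i ^ᶠ m ≟ 1#))
  ... | yes (i , aᵢ≉0 , aᵢᵐ≉1) = sums-to-zero (fixed-by-non-one (power-sum-scaling m aᵢ≉0) aᵢᵐ≉1)
  ... | no ∄non-root = ⊥-elim (not-all-roots-of-unity m 1≤m m+2≤q (λ i aᵢ≉0 →
          decidable-stable (elt i ^ᶠ m ≟ 1#) (λ aᵢᵐ≉1 → ∄non-root (i , aᵢ≉0 , aᵢᵐ≉1))))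

  power-difference-matrix : ℕ → Matrix F q
  power-difference-matrix t i j = elt j ^ᶠ t - elt i ^ᶠ t

  -- The product of the t- and s-matrices vanishes once the power sums of
  -- orders t, s and t + s do.
  power-difference-matrices-annihilate : ∀ t s → 1 ≤ t → 1 ≤ s → ℕ.suc (t ℕ.+ s) < q →
    IsZeroMatrix F (_⊗_ F (power-difference-matrix t) (power-difference-matrix s))
  power-difference-matrices-annihilate t s 1≤t 1≤s t+s+2≤q i k =
    sum≈0 (product-of-differences (λ j → elt j ^ᶠ t) (λ j → elt j ^ᶠ s) (elt i ^ᶠ t) (elt k ^ᶠ s)
             sum-of-ones (power-sum-vanishes t 1≤t (≤-<-trans (ℕ.s≤s (m≤m+n t s)) t+s+2≤q))
             (power-sum-vanishes s 1≤s (≤-<-trans (ℕ.s≤s (m≤n+m s t)) t+s+2≤q))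
             (sumsToZero-cong (λ j → ^-homo-* (elt j) t s)
               (power-sum-vanishes (t ℕ.+ s) (≤-trans 1≤t (m≤m+n t s)) t+s+2≤q)))

-- 2t < r and 2s < r give t + s < r, since t + s ≤ 2·max(t, s).
+-<-from-doubles : ∀ {t s r} → 2 * t < r → 2 * s < r → t ℕ.+ s < r
+-<-from-doubles {t} {s} 2t<r 2s<r with ≤-total t s
... | inj₁ t≤s = ≤-<-trans (+-monoˡ-≤ s t≤s) (≤-<-trans (+-monoʳ-≤ s (m≤m+n s 0)) 2s<r)
... | inj₂ s≤t = ≤-<-trans (+-monoʳ-≤ t s≤t) (≤-<-trans (+-monoʳ-≤ t (m≤m+n t 0)) 2t<r)

<∸1⇒suc< : ∀ {m n} → m < n ∸ 1 → ℕ.suc m < n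
<∸1⇒suc< {n = ℕ.suc n} m<n = ℕ.s≤s m<n

theorem3 : ∀ {c ℓ} (F : Field c ℓ) (p α q : ℕ) → Prime p → 1 ≤ α → q ≡ p ^ α →
           (L : Listing F q) →
           (∀ (i : Fin q) → toℕ i ≡ 0 → Field._≈_ F (Listing.elt L i) (Field.0# F)) →
           (t s : ℕ) → 1 ≤ t → 2 * t < q ∸ 1 → 1 ≤ s → 2 * s < q ∸ 1 →
           IsZeroMatrix F (_⊗_ F
             (λ i j → Field._-_ F (Field._^_ F (Listing.elt L j) t) (Field._^_ F (Listing.elt L i) t))
             (λ i j → Field._-_ F (Field._^_ F (Listing.elt L j) s) (Field._^_ F (Listing.elt L i) s)))
theorem3 F p α q _ _ _ L _ t s 1≤t 2t<q-1 1≤s 2s<q-1 =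
  FiniteField.power-difference-matrices-annihilate F L t s 1≤t 1≤s
    (<∸1⇒suc< (+-<-from-doubles {t} {s} 2t<q-1 2s<q-1))
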